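{- Let $G$ be a finite simple graph, with $(H,H')$, $M$, $H_A$ as in the standing setting below. Then $|H_A|\ge 2(\nu(G)-\alpha_2(G))$.
   Context: $\nu(G)$ is the maximum matching size. $B_2(G)$ is the set of pairs $(H,H')$ of edge-disjoint matchings; $\lambda_2(G)=\max\{|H|+|H'|:(H,H')\in B_2(G)\}$; $\alpha_2(G)=\max\{|H|,|H'|:(H,H')\in B_2(G),\ |H|+|H'|=\lambda_2(G)\}$; $M_2(G)=\{(H,H')\in B_2(G): |H|+|H'|=\lambda_2(G),\ |H|=\alpha_2(G)\}$. For matchings $A,B$: a path $e_1,\dots,e_l$ ($l\ge1$) is $A$-$B$ alternating if the edges with odd indices lie in $A\setminus B$ and the others in $B\setminus A$, or vice versa; it is maximal if it is not a proper subpath of another $A$-$B$ alternating path. $P_o^A(A,B)$ is the set of maximal $A$-$B$ alternating paths of odd length whose first edge is in $A$. Standing setting: over all $(H,H')\in M_2(G)$ and all maximum matchings $M$ of $G$, consider the triples maximizing $|M\cap H|$; among these, $((H,H'),M)$ is chosen to maximize $|M\cap H'|$. $H_A$ is the set of edges lying on paths of $P_o^M(M,H)$ that belong to $H$. -}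

module Defs where

open import Data.Nat using (ℕ; zero; suc; _+_; _*_; _∸_; _≤_; _<_)
open import Data.Fin using (Fin)
open import Data.Fin.Subset using (Subset; _∈_; _∉_; _∩_; ∣_∣)
open import Data.Product using (Σ; ∃; ∃-syntax; _×_; _,_; proj₁; proj₂)
open import Data.Sum using (_⊎_)
open import Data.Unit using (⊤)
open import Data.Empty using (⊥)
open import Data.List using (List; []; _∷_; length; _++_; reverse)
open import Data.List.Relation.Unary.Any using (Any)
open import Data.List.Relation.Unary.Unique.Propositional using (Unique)
open import Relation.Nullary using (¬_)
open import Relation.Binary.PropositionalEquality using (_≡_; _≢_)

SamePair : {A : Set} → A × A → A × A → Set
SamePair (a , b) (c , d) = (a ≡ c × b ≡ d) ⊎ (a ≡ d × b ≡ c)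

record Graph : Set where
  field
    n : ℕ
    m : ℕ
    ends : Fin m → Fin n × Fin n
    loopless : ∀ e → proj₁ (ends e) ≢ proj₂ (ends e)
    simple : ∀ e f → SamePair (ends e) (ends f) → e ≡ f

open Graph public

EdgeSet : Graph → Set
EdgeSet G = Subset (m G)

Incident : (G : Graph) → Fin (m G) → Fin (n G) → Set
Incident G e v = v ≡ proj₁ (ends G e) ⊎ v ≡ proj₂ (ends G e)

Matching : (G : Graph) → EdgeSet G → Set
Matching G S = ∀ e f → e ∈ S → f ∈ S → e ≢ f →
  ∀ v → Incident G e v → Incident G f v → ⊥

MaximumMatching : (G : Graph) → EdgeSet G → Set
MaximumMatching G M = Matching G M × (∀ T → Matching G T → ∣ T ∣ ≤ ∣ M ∣)

IsNu : (G : Graph) → ℕ → Set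
IsNu G k = (Σ (EdgeSet G) λ S → Matching G S × ∣ S ∣ ≡ k)
         × (∀ S → Matching G S → ∣ S ∣ ≤ k)

B2 : (G : Graph) → EdgeSet G → EdgeSet G → Set
B2 G H H' = Matching G H × Matching G H' × (∀ e → e ∈ H → e ∉ H')

IsLambda2 : (G : Graph) → ℕ → Set
IsLambda2 G l = (Σ (EdgeSet G) λ H → Σ (EdgeSet G) λ H' → B2 G H H' × ∣ H ∣ + ∣ H' ∣ ≡ l)
              × (∀ H H' → B2 G H H' → ∣ H ∣ + ∣ H' ∣ ≤ l)

IsAlpha2 : (G : Graph) → ℕ → Set
IsAlpha2 G a = Σ ℕ λ l → IsLambda2 G l
  × (Σ (EdgeSet G) λ H → Σ (EdgeSet G) λ H' → B2 G H H' × ∣ H ∣ + ∣ H' ∣ ≡ l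
       × (∣ H ∣ ≡ a ⊎ ∣ H' ∣ ≡ a))
  × (∀ H H' → B2 G H H' → ∣ H ∣ + ∣ H' ∣ ≡ l → ∣ H ∣ ≤ a × ∣ H' ∣ ≤ a)

InM2 : (G : Graph) → EdgeSet G → EdgeSet G → Set
InM2 G H H' = B2 G H H' × Σ ℕ λ l → Σ ℕ λ a →
  IsLambda2 G l × IsAlpha2 G a × ∣ H ∣ + ∣ H' ∣ ≡ l × ∣ H ∣ ≡ a

Admissible : (G : Graph) → EdgeSet G → EdgeSet G → EdgeSet G → Set
Admissible G H H' M = InM2 G H H' × MaximumMatching G M

StandingChoice : (G : Graph) → EdgeSet G → EdgeSet G → EdgeSet G → Set
StandingChoice G H H' M = Admissible G H H' M
  × (∀ K K' N → Admissible G K K' N → ∣ N ∩ K ∣ ≤ ∣ M ∩ H ∣)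
  × (∀ K K' N → Admissible G K K' N → ∣ N ∩ K ∣ ≡ ∣ M ∩ H ∣ → ∣ N ∩ K' ∣ ≤ ∣ M ∩ H' ∣)

Joins : (G : Graph) → Fin (m G) → Fin (n G) → Fin (n G) → Set
Joins G e v w = SamePair (ends G e) (v , w)

Connects : (G : Graph) → List (Fin (n G)) → List (Fin (m G)) → Set
Connects G (v ∷ []) [] = ⊤
Connects G (v ∷ w ∷ vs) (e ∷ es) = Joins G e v w × Connects G (w ∷ vs) es
Connects G _ _ = ⊥

IsPath : (G : Graph) → List (Fin (m G)) → Set
IsPath G es = Σ (List (Fin (n G))) λ vs → Unique vs × Connects G vs es

AltSeq : {k : ℕ} → Subset k → Subset k → List (Fin k) → Set
AltSeq A B [] = ⊤
AltSeq A B (e ∷ es) = (e ∈ A × e ∉ B) × AltSeq B A es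

IsAltPath : (G : Graph) → EdgeSet G → EdgeSet G → List (Fin (m G)) → Set
IsAltPath G A B es = IsPath G es × 1 ≤ length es × (AltSeq A B es ⊎ AltSeq B A es)

-- es is a proper subpath of fs (paths are unoriented, so fs may be reversed)
ProperSubpath : {k : ℕ} → List (Fin k) → List (Fin k) → Set
ProperSubpath es fs = length es < length fs
  × ∃[ xs ] ∃[ ys ] (xs ++ es ++ ys ≡ fs ⊎ xs ++ es ++ ys ≡ reverse fs)

IsMaximalAltPath : (G : Graph) → EdgeSet G → EdgeSet G → List (Fin (m G)) → Set
IsMaximalAltPath G A B es = IsAltPath G A B es
  × (∀ fs → IsAltPath G A B fs → ¬ ProperSubpath es fs)

InPoA : (G : Graph) → EdgeSet G → EdgeSet G → List (Fin (m G)) → Set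
InPoA G A B es = IsMaximalAltPath G A B es
  × (∃[ k ] length es ≡ suc (2 * k))
  × Σ (Fin (m G)) λ e → Σ (List (Fin (m G))) λ rest → es ≡ e ∷ rest × e ∈ A

InHA : (G : Graph) → EdgeSet G → EdgeSet G → Fin (m G) → Set
InHA G H M e = e ∈ H × Σ (List (Fin (m G))) λ es → InPoA G M H es × Any (e ≡_) es

-- Charge each of the 2|M| endpoints of
-- M-edges. An endpoint covered by H is charged to that endpoint of its H-edge. From an H-exposed
-- endpoint v, follow the unique walk alternating between M∖H and H∖M that starts with the M-edge
-- at v. If it has even length, it ends with an H-edge at an M-exposed vertex, and v is charged
-- to that end of the H-edge. Odd length 1 or 3 would give an H-augmenting path, and moving edges
-- between H and H' along it would contradict (H , H') ∈ M₂(G). So otherwise the walk is a path of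
-- P_o^M(M,H) of length at least 5, and v is charged to its second edge, which lies in H_A. A step
-- of such a walk is determined by its target as well as by its source, so charges are distinct
-- and 2|M| ≤ 2|H| + |H_A|; finally |M| = ν(G) and |H| = α₂(G).

module Submission where

open import Defs
open import Data.Bool using (Bool; true; false; not)
open import Data.Bool.Properties using (not-injective; not-involutive; not-¬; ¬-not) renaming (_≟_ to _≟ᵇ_)
open import Data.Empty using (⊥; ⊥-elim)
open import Data.Fin using (Fin; zero; suc; toℕ) renaming (_≟_ to _≟ᶠ_)
open import Data.Fin.Properties using (pigeonhole; toℕ≤n; any?) renaming (suc-injective to fsuc-injective)
open import Data.Fin.Subset using (Subset; _∈_; _∉_; _⊆_; ∣_∣; _∪_; ⁅_⁆; _-_; inside; outside)
open import Data.Fin.Subset.Properties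
  using (_∈?_; x∈p∪q⁻; x∈p∪q⁺; x∈⁅x⁆; x∈⁅y⁆⇒x≡y; p⊆q⇒∣p∣≤∣q∣; p⊂q⇒∣p∣<∣q∣; p⊆p∪q; p─q⊆p; drop-there; x∈p∧x≢y⇒x∈p-y)
open import Data.List using (List; []; _∷_; initLast; _∷ʳ′_; length; map; _++_; reverse; applyUpTo; cartesianProduct)
open import Data.List.Properties
  using (length-map; length-++; length-applyUpTo; ++-assoc; ++-identityʳ; reverse-++; reverse-involutive; length-reverse)
open import Data.List.Membership.Propositional using () renaming (_∈_ to _∈ₗ_)
open import Data.List.Membership.Propositional.Properties
  using (∈-map⁺; ∈-map⁻; ∈-++⁺ˡ; ∈-++⁺ʳ; ∈-++⁻; ∈-∃++; ∈-cartesianProduct⁺; ∈-cartesianProduct⁻)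
open import Data.List.Relation.Unary.All using (All; []; _∷_; universal) renaming (lookup to All-lookup)
open import Data.List.Relation.Unary.All.Properties using () renaming (map⁺ to All-map⁺)
open import Data.List.Relation.Unary.AllPairs using ([]; _∷_)
open import Data.List.Relation.Unary.Any using (here; there)
import Data.List.Relation.Unary.Any.Properties as Any
open import Data.List.Relation.Unary.Unique.Propositional using (Unique)
import Data.List.Relation.Unary.Unique.Propositional.Properties as Unique
open import Data.Nat using (ℕ; zero; suc; _+_; _*_; _∸_; _≤_; _<_; z≤n; s≤s; z<s; s<s)
open import Data.Nat.Properties
open import Data.Product using (∃-syntax; _×_; _,_; proj₁; proj₂)
import Data.Product as Product
open import Data.Sum using (_⊎_; inj₁; inj₂)
import Data.Sum as Sum
open import Data.Unit using (tt)
open import Data.Vec using ([]; _∷_; here; there; tail)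
open import Function using (_∘_; flip)
open import Function.Bundles using (_⇔_; Equivalence)
open import Relation.Binary.Construct.Closure.ReflexiveTransitive using (Star; ε; _◅_)
open import Relation.Binary.PropositionalEquality
open import Relation.Nullary using (¬_; Dec; yes; no)
open import Relation.Nullary.Decidable using (_×-dec_; _⊎-dec_; ¬?)

private
  variable
    k : ℕ
    A B : Set

x∈p∪⁅y⁆⁻ : ∀ {p : Subset k} {x y} → x ∈ p ∪ ⁅ y ⁆ → x ∈ p ⊎ x ≡ y
x∈p∪⁅y⁆⁻ {p = p} {y = y} x∈ = Sum.map₂ (x∈⁅y⁆⇒x≡y y) (x∈p∪q⁻ p ⁅ y ⁆ x∈)

x∈p∪⁅y⁆⁺ : ∀ {p : Subset k} {x y} → x ∈ p ⊎ x ≡ y → x ∈ p ∪ ⁅ y ⁆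
x∈p∪⁅y⁆⁺ (inj₁ x∈p) = x∈p∪q⁺ (inj₁ x∈p)
x∈p∪⁅y⁆⁺ (inj₂ refl) = x∈p∪q⁺ (inj₂ (x∈⁅x⁆ _))

x∉p⇒∣p∣<∣p∪⁅x⁆∣ : ∀ {p : Subset k} {x} → x ∉ p → ∣ p ∣ < ∣ p ∪ ⁅ x ⁆ ∣
x∉p⇒∣p∣<∣p∪⁅x⁆∣ {x = x} x∉p = p⊂q⇒∣p∣<∣q∣ (p⊆p∪q ⁅ x ⁆ , x , x∈p∪⁅y⁆⁺ (inj₂ refl) , x∉p)

x∉p-x : ∀ (p : Subset k) x → x ∉ p - x
x∉p-x (_ ∷ p) zero ()
x∉p-x (_ ∷ p) (suc x) (there x∈) = x∉p-x p x x∈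

x∈p-y⁻ : ∀ {p : Subset k} {x y} → x ∈ p - y → x ∈ p × x ≢ y
x∈p-y⁻ {p = p} {y = y} x∈ = p─q⊆p p ⁅ y ⁆ x∈ , λ { refl → x∉p-x p y x∈ }

x∉p⇒∣p∣≤∣p-x∣ : ∀ {p : Subset k} {x} → x ∉ p → ∣ p ∣ ≤ ∣ p - x ∣
x∉p⇒∣p∣≤∣p-x∣ {p = p} {x} x∉p = p⊆q⇒∣p∣≤∣q∣ {q = p - x} λ y∈p → x∈p∧x≢y⇒x∈p-y y∈p λ { refl → x∉p y∈p }

∣p∣≤1+∣p-x∣ : ∀ (p : Subset k) x → ∣ p ∣ ≤ suc ∣ p - x ∣
∣p∣≤1+∣p-x∣ (b ∷ p) zero    = ≤-trans (∣b∷p∣≤1+∣p∣ b) (s≤s (p⊆q⇒∣p∣≤∣q∣ {q = tail ((b ∷ p) - zero)} λ y∈p →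
  drop-there (x∈p∧x≢y⇒x∈p-y {p = b ∷ p} {y = zero} (there y∈p) λ ())))
  where
  ∣b∷p∣≤1+∣p∣ : ∀ b → ∣ b ∷ p ∣ ≤ suc ∣ p ∣
  ∣b∷p∣≤1+∣p∣ outside = n≤1+n _
  ∣b∷p∣≤1+∣p∣ inside  = ≤-refl
∣p∣≤1+∣p-x∣ (outside ∷ p) (suc x) = ∣p∣≤1+∣p-x∣ p x
∣p∣≤1+∣p-x∣ (inside  ∷ p) (suc x) = s≤s (∣p∣≤1+∣p-x∣ p x)

elements : Subset k → List (Fin k)
elements []            = []
elements (inside  ∷ p) = zero ∷ map suc (elements p)
elements (outside ∷ p) = map suc (elements p)

length-elements : ∀ (p : Subset k) → length (elements p) ≡ ∣ p ∣
length-elements []            = refl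
length-elements (inside  ∷ p) = cong suc (trans (length-map suc (elements p)) (length-elements p))
length-elements (outside ∷ p) = trans (length-map suc (elements p)) (length-elements p)

∈-elements⁺ : ∀ {p : Subset k} {x} → x ∈ p → x ∈ₗ elements p
∈-elements⁺ {p = inside  ∷ p} {zero}  _          = here refl
∈-elements⁺ {p = inside  ∷ p} {suc x} (there x∈) = there (∈-map⁺ suc (∈-elements⁺ x∈))
∈-elements⁺ {p = outside ∷ p} {suc x} (there x∈) = ∈-map⁺ suc (∈-elements⁺ x∈)

∈-elements⁻ : ∀ {p : Subset k} {x} → x ∈ₗ elements p → x ∈ p
∈-elements⁻ {p = inside  ∷ p} (here refl) = here
∈-elements⁻ {p = inside  ∷ p} (there x∈) with ∈-map⁻ suc x∈
... | _ , y∈ , refl = there (∈-elements⁻ y∈)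
∈-elements⁻ {p = outside ∷ p} x∈ with ∈-map⁻ suc x∈
... | _ , y∈ , refl = there (∈-elements⁻ y∈)

elements-unique : ∀ (p : Subset k) → Unique (elements p)
elements-unique []            = []
elements-unique (inside  ∷ p) = zero∉ ∷ Unique.map⁺ fsuc-injective (elements-unique p)
  where
  zero∉ : All (zero ≢_) (map suc (elements p))
  zero∉ = All-map⁺ (universal (λ _ ()) (elements p))
elements-unique (outside ∷ p) = Unique.map⁺ fsuc-injective (elements-unique p)

length-cartesianProduct : ∀ (xs : List A) (ys : List B) →
  length (cartesianProduct xs ys) ≡ length xs * length ys
length-cartesianProduct []       ys = refl
length-cartesianProduct (x ∷ xs) ys = begin
  length (map (x ,_) ys ++ cartesianProduct xs ys)          ≡⟨ length-++ (map (x ,_) ys) ⟩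
  length (map (x ,_) ys) + length (cartesianProduct xs ys)  ≡⟨ cong₂ _+_ (length-map (x ,_) ys) (length-cartesianProduct xs ys) ⟩
  length ys + length xs * length ys                         ∎
  where open ≡-Reasoning

injection⇒length≤ : (R : A → B → Set) → (∀ {x x' y} → R x y → R x' y → x ≡ x') →
  ∀ {xs ys} → Unique xs → (∀ {x} → x ∈ₗ xs → ∃[ y ] y ∈ₗ ys × R x y) → length xs ≤ length ys
injection⇒length≤ R R-injective {[]}     _                  _     = z≤n
injection⇒length≤ R R-injective {x ∷ xs} {ys} (x∉xs ∷ xs-unique) image
  with y , y∈ys , Rxy ← image (here refl)
  with us , vs , refl ← ∈-∃++ y∈ys = begin
    suc (length xs)              ≤⟨ s≤s (injection⇒length≤ R R-injective xs-unique image′) ⟩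
    suc (length (us ++ vs))      ≡⟨ cong suc (length-++ us) ⟩
    suc (length us + length vs)  ≡⟨ +-suc (length us) (length vs) ⟨
    length us + length (y ∷ vs)  ≡⟨ length-++ us ⟨
    length (us ++ y ∷ vs)        ∎
  where
  open ≤-Reasoning
  image′ : ∀ {x'} → x' ∈ₗ xs → ∃[ y' ] y' ∈ₗ us ++ vs × R x' y'
  image′ x'∈xs with y' , y'∈ , Rx'y' ← image (there x'∈xs) with ∈-++⁻ us y'∈
  ... | inj₁ y'∈us         = y' , ∈-++⁺ˡ y'∈us , Rx'y'
  ... | inj₂ (here refl)   = ⊥-elim (All-lookup x∉xs x'∈xs (R-injective Rxy Rx'y'))
  ... | inj₂ (there y'∈vs) = y' , ∈-++⁺ʳ us y'∈vs , Rx'y'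

Exposed : (G : Graph) → EdgeSet G → Fin (n G) → Set
Exposed G T v = ∀ {g} → g ∈ T → ¬ Incident G g v

endpoint : (G : Graph) → Fin (m G) → Bool → Fin (n G)
endpoint G e true  = proj₁ (ends G e)
endpoint G e false = proj₂ (ends G e)

module GraphFacts (G : Graph) where

  private
    variable
      e f : Fin (m G)
      u v v' w w' : Fin (n G)
      T : EdgeSet G

  joins-incidentˡ : Joins G e v w → Incident G e v
  joins-incidentˡ (inj₁ (refl , _)) = inj₁ refl
  joins-incidentˡ (inj₂ (_ , refl)) = inj₂ refl

  joins-incidentʳ : Joins G e v w → Incident G e w
  joins-incidentʳ (inj₁ (_ , refl)) = inj₂ refl
  joins-incidentʳ (inj₂ (refl , _)) = inj₁ refl

  joins-sym : Joins G e v w → Joins G e w v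
  joins-sym (inj₁ (p , q)) = inj₂ (p , q)
  joins-sym (inj₂ (p , q)) = inj₁ (p , q)

  joins-irreflexive : ¬ Joins G e v v
  joins-irreflexive {e} (inj₁ (p , q)) = loopless G e (trans p (sym q))
  joins-irreflexive {e} (inj₂ (p , q)) = loopless G e (trans p (sym q))

  joins-endpoints : Joins G e v w → Joins G e v' w' → (v ≡ v' × w ≡ w') ⊎ (v ≡ w' × w ≡ v')
  joins-endpoints (inj₁ (p , q)) (inj₁ (p' , q')) = inj₁ (trans (sym p) p' , trans (sym q) q')
  joins-endpoints (inj₁ (p , q)) (inj₂ (p' , q')) = inj₂ (trans (sym p) p' , trans (sym q) q')
  joins-endpoints (inj₂ (p , q)) (inj₁ (p' , q')) = inj₂ (trans (sym q) q' , trans (sym p) p')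
  joins-endpoints (inj₂ (p , q)) (inj₂ (p' , q')) = inj₁ (trans (sym q) q' , trans (sym p) p')

  joins-functional : Joins G e v w → Joins G e v w' → w ≡ w'
  joins-functional j j' with joins-endpoints j j'
  ... | inj₁ (_ , w≡w') = w≡w'
  ... | inj₂ (_ , w≡v)  = ⊥-elim (joins-irreflexive (subst (Joins G _ _) w≡v j))

  incident-joins : Joins G e v w → Incident G e u → u ≡ v ⊎ u ≡ w
  incident-joins (inj₁ (refl , refl)) e∋u = e∋u
  incident-joins (inj₂ (refl , refl)) e∋u = Sum.swap e∋u

  incident-endpoint : Incident G e v → ∃[ b ] endpoint G e b ≡ v
  incident-endpoint (inj₁ refl) = true , refl
  incident-endpoint (inj₂ refl) = false , refl

  endpoint-incident : ∀ e b → Incident G e (endpoint G e b)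
  endpoint-incident e true  = inj₁ refl
  endpoint-incident e false = inj₂ refl

  opposite : Fin (m G) → Fin (n G) → Fin (n G)
  opposite e v with v ≟ᶠ proj₁ (ends G e)
  ... | yes _ = proj₂ (ends G e)
  ... | no  _ = proj₁ (ends G e)

  incident⇒joins-opposite : Incident G e v → Joins G e v (opposite e v)
  incident⇒joins-opposite {e} {v} e∋v with v ≟ᶠ proj₁ (ends G e) | e∋v
  ... | yes v≡ | _          = inj₁ (sym v≡ , refl)
  ... | no  v≢ | inj₁ v≡    = ⊥-elim (v≢ v≡)
  ... | no  _  | inj₂ refl  = inj₂ (refl , refl)

  incident? : ∀ e v → Dec (Incident G e v)
  incident? e v = (v ≟ᶠ proj₁ (ends G e)) ⊎-dec (v ≟ᶠ proj₂ (ends G e))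

  matching-unique : Matching G T → e ∈ T → f ∈ T → Incident G e v → Incident G f v → e ≡ f
  matching-unique {e = e} {f} T-matching e∈T f∈T e∋v f∋v with e ≟ᶠ f
  ... | yes e≡f = e≡f
  ... | no  e≢f = ⊥-elim (T-matching e f e∈T f∈T e≢f _ e∋v f∋v)

  matching-⊆ : ∀ {T'} → T' ⊆ T → Matching G T → Matching G T'
  matching-⊆ T'⊆T T-matching e f e∈ f∈ = T-matching e f (T'⊆T e∈) (T'⊆T f∈)

  matching-∪⁅⁆ : Matching G T → (∀ {g x} → g ∈ T → Incident G e x → ¬ Incident G g x) →
                 Matching G (T ∪ ⁅ e ⁆)
  matching-∪⁅⁆ {T} T-matching apart g g' g∈ g'∈ g≢g' x g∋x g'∋x
    with x∈p∪⁅y⁆⁻ {p = T} g∈ | x∈p∪⁅y⁆⁻ {p = T} g'∈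
  ... | inj₁ g∈T | inj₁ g'∈T = T-matching g g' g∈T g'∈T g≢g' x g∋x g'∋x
  ... | inj₁ g∈T | inj₂ refl = apart g∈T g'∋x g∋x
  ... | inj₂ refl | inj₁ g'∈T = apart g'∈T g∋x g'∋x
  ... | inj₂ refl | inj₂ refl = g≢g' refl

  matching-dart-injective : Matching G T → ∀ {e e' b b'} → e ∈ T → e' ∈ T →
    endpoint G e b ≡ endpoint G e' b' → (e , b) ≡ (e' , b')
  matching-dart-injective T-matching {e} {e'} {b} {b'} e∈T e'∈T same
    with matching-unique T-matching e∈T e'∈T (endpoint-incident e b)
           (subst (Incident G e') (sym same) (endpoint-incident e' b'))
  matching-dart-injective _ {b = true}  {true}  _ _ _    | refl = refl
  matching-dart-injective _ {b = true}  {false} _ _ same | refl = ⊥-elim (loopless G _ same)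
  matching-dart-injective _ {b = false} {true}  _ _ same | refl = ⊥-elim (loopless G _ (sym same))
  matching-dart-injective _ {b = false} {false} _ _ _    | refl = refl

-- Exchange arguments in M₂(G)

λ₂-unique : ∀ {G l l'} → IsLambda2 G l → IsLambda2 G l' → l ≡ l'
λ₂-unique ((K , K' , KK' , KK'≡l) , bound) ((J , J' , JJ' , JJ'≡l') , bound') =
  ≤-antisym (subst (_≤ _) KK'≡l (bound' K K' KK')) (subst (_≤ _) JJ'≡l' (bound J J' JJ'))

-- The consequence of (H , H') ∈ M₂(G) that the exchange arguments use.
FirstMaximal : (G : Graph) → EdgeSet G → EdgeSet G → Set
FirstMaximal G H H' = ∀ K K' → B2 G K K' → ∣ H ∣ + ∣ H' ∣ ≤ ∣ K ∣ + ∣ K' ∣ → ∣ K ∣ ≤ ∣ H ∣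

InM2⇒FirstMaximal : ∀ {G H H'} → InM2 G H H' → FirstMaximal G H H'
InM2⇒FirstMaximal {G} (_ , l , a , λ₂ , (l' , λ₂' , _ , bound) , total , ∣H∣≡a) K K' KK' ≤total =
  subst (∣ K ∣ ≤_) (sym ∣H∣≡a) (proj₁ (bound K K' KK' total′))
  where
  total′ : ∣ K ∣ + ∣ K' ∣ ≡ l'
  total′ = trans (≤-antisym (proj₂ λ₂ K K' KK') (subst (_≤ _) total ≤total)) (λ₂-unique {G} λ₂ λ₂')

-- A first-maximal pair admits no H-augmenting path of length 1 or 3: augmenting H along
-- it gains one edge while H' loses at most one, which first-maximality forbids.
module Exchange {G : Graph} {H H' : EdgeSet G} (HH' : B2 G H H') (first-maximal : FirstMaximal G H H') where

  open GraphFacts G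

  private
    H-matching  = proj₁ HH'
    H'-matching = proj₁ (proj₂ HH')
    H∩H'=∅      = proj₂ (proj₂ HH')

  no-improving-exchange : ∀ K K' → B2 G K K' → ∣ H ∣ < ∣ K ∣ → ∣ H' ∣ ≤ suc ∣ K' ∣ → ⊥
  no-improving-exchange K K' KK' ∣H∣<∣K∣ ∣H'∣≤ = <⇒≱ ∣H∣<∣K∣ (first-maximal K K' KK' (begin
    ∣ H ∣ + ∣ H' ∣       ≤⟨ +-monoʳ-≤ ∣ H ∣ ∣H'∣≤ ⟩
    ∣ H ∣ + suc ∣ K' ∣   ≡⟨ +-suc ∣ H ∣ ∣ K' ∣ ⟩
    suc ∣ H ∣ + ∣ K' ∣   ≤⟨ +-monoˡ-≤ ∣ K' ∣ ∣H∣<∣K∣ ⟩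
    ∣ K ∣ + ∣ K' ∣       ∎))
    where open ≤-Reasoning

  no-augmenting-edge : ∀ {e} → e ∉ H → (∀ {x} → Incident G e x → Exposed G H x) → ⊥
  no-augmenting-edge {e} e∉H exposed =
    no-improving-exchange (H ∪ ⁅ e ⁆) (H' - e) (K-matching , K'-matching , disjoint)
      (x∉p⇒∣p∣<∣p∪⁅x⁆∣ e∉H) (∣p∣≤1+∣p-x∣ H' e)
    where
    K-matching : Matching G (H ∪ ⁅ e ⁆)
    K-matching = matching-∪⁅⁆ H-matching λ g∈H e∋x g∋x → exposed e∋x g∈H g∋x
    K'-matching : Matching G (H' - e)
    K'-matching = matching-⊆ (proj₁ ∘ x∈p-y⁻) H'-matching
    disjoint : ∀ g → g ∈ H ∪ ⁅ e ⁆ → g ∉ H' - e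
    disjoint g g∈K g∈K' with x∈p∪⁅y⁆⁻ {p = H} g∈K | x∈p-y⁻ {p = H'} g∈K'
    ... | inj₁ g∈H  | g∈H' , _ = H∩H'=∅ g g∈H g∈H'
    ... | inj₂ refl | _ , g≢e  = g≢e refl

  module AugmentingPath3 {a₁ f a₃} (a₁∉H : a₁ ∉ H) (a₃∉H : a₃ ∉ H) (f∈H : f ∈ H)
    (apart : ∀ {x} → Incident G a₁ x → ¬ Incident G a₃ x)
    (f-between : ∀ {x} → Incident G f x → Incident G a₁ x ⊎ Incident G a₃ x)
    (at-a₁ : ∀ {g x} → g ∈ H → Incident G a₁ x → Incident G g x → g ≡ f)
    (at-a₃ : ∀ {g x} → g ∈ H → Incident G a₃ x → Incident G g x → g ≡ f) where

    K₀ = H - f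
    K₁ = K₀ ∪ ⁅ a₁ ⁆
    K  = K₁ ∪ ⁅ a₃ ⁆
    R  = H' - a₁ - a₃

    a₁≢a₃ : a₁ ≢ a₃
    a₁≢a₃ refl = apart (inj₁ refl) (inj₁ refl)

    ∈K₀⁻ : ∀ {g} → g ∈ K₀ → g ∈ H × g ≢ f
    ∈K₀⁻ = x∈p-y⁻ {p = H}

    ∈K⁻ : ∀ {g} → g ∈ K → (g ∈ H × g ≢ f) ⊎ g ≡ a₁ ⊎ g ≡ a₃
    ∈K⁻ g∈K with x∈p∪⁅y⁆⁻ {p = K₁} g∈K
    ... | inj₂ g≡a₃ = inj₂ (inj₂ g≡a₃)
    ... | inj₁ g∈K₁ with x∈p∪⁅y⁆⁻ {p = K₀} g∈K₁
    ...   | inj₁ g∈K₀ = inj₁ (∈K₀⁻ g∈K₀)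
    ...   | inj₂ g≡a₁ = inj₂ (inj₁ g≡a₁)

    ∈R⁻ : ∀ {g} → g ∈ R → g ∈ H' × g ≢ a₁ × g ≢ a₃
    ∈R⁻ g∈R with x∈p-y⁻ {p = H' - a₁} g∈R
    ... | g∈ , g≢a₃ with x∈p-y⁻ {p = H'} g∈
    ...   | g∈H' , g≢a₁ = g∈H' , g≢a₁ , g≢a₃

    K-matching : Matching G K
    K-matching = matching-∪⁅⁆ K₁-matching λ g∈K₁ a₃∋x g∋x → avoids-a₃ (x∈p∪⁅y⁆⁻ {p = K₀} g∈K₁) a₃∋x g∋x
      where
      K₁-matching : Matching G K₁
      K₁-matching = matching-∪⁅⁆ (matching-⊆ (proj₁ ∘ ∈K₀⁻) H-matching) λ g∈K₀ a₁∋x g∋x →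
        proj₂ (∈K₀⁻ g∈K₀) (at-a₁ (proj₁ (∈K₀⁻ g∈K₀)) a₁∋x g∋x)
      avoids-a₃ : ∀ {g x} → g ∈ K₀ ⊎ g ≡ a₁ → Incident G a₃ x → ¬ Incident G g x
      avoids-a₃ (inj₁ g∈K₀) a₃∋x g∋x = proj₂ (∈K₀⁻ g∈K₀) (at-a₃ (proj₁ (∈K₀⁻ g∈K₀)) a₃∋x g∋x)
      avoids-a₃ (inj₂ refl) a₃∋x g∋x = apart g∋x a₃∋x

    ∣H∣<∣K∣ : ∣ H ∣ < ∣ K ∣
    ∣H∣<∣K∣ = begin-strict
      ∣ H ∣        ≤⟨ ∣p∣≤1+∣p-x∣ H f ⟩
      suc ∣ K₀ ∣   ≤⟨ x∉p⇒∣p∣<∣p∪⁅x⁆∣ (a₁∉H ∘ proj₁ ∘ ∈K₀⁻) ⟩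
      ∣ K₁ ∣       <⟨ x∉p⇒∣p∣<∣p∪⁅x⁆∣ a₃∉K₁ ⟩
      ∣ K ∣        ∎
      where
      open ≤-Reasoning
      a₃∉K₁ : a₃ ∉ K₁
      a₃∉K₁ a₃∈K₁ with x∈p∪⁅y⁆⁻ {p = K₀} a₃∈K₁
      ... | inj₁ a₃∈K₀ = a₃∉H (proj₁ (∈K₀⁻ a₃∈K₀))
      ... | inj₂ a₃≡a₁ = a₁≢a₃ (sym a₃≡a₁)

    K∩R=∅ : ∀ g → g ∈ K → g ∉ R
    K∩R=∅ g g∈K g∈R with ∈K⁻ g∈K | ∈R⁻ g∈R
    ... | inj₁ (g∈H , _)   | g∈H' , _      = H∩H'=∅ g g∈H g∈H'
    ... | inj₂ (inj₁ g≡a₁) | _ , g≢a₁ , _ = g≢a₁ g≡a₁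
    ... | inj₂ (inj₂ g≡a₃) | _ , _ , g≢a₃ = g≢a₃ g≡a₃

    KR : B2 G K R
    KR = K-matching , matching-⊆ (proj₁ ∘ ∈R⁻) H'-matching , K∩R=∅

    -- When both a₁ and a₃ lie in H', the edge f can replace them there.
    KRf : a₁ ∈ H' → a₃ ∈ H' → B2 G K (R ∪ ⁅ f ⁆)
    KRf a₁∈H' a₃∈H' = K-matching , matching-∪⁅⁆ (proj₁ (proj₂ KR)) avoids-f , K∩K'=∅
      where
      avoids-f : ∀ {g x} → g ∈ R → Incident G f x → ¬ Incident G g x
      avoids-f g∈R f∋x g∋x with ∈R⁻ g∈R | f-between f∋x
      ... | g∈H' , g≢a₁ , _ | inj₁ a₁∋x = H'-matching _ a₁ g∈H' a₁∈H' g≢a₁ _ g∋x a₁∋x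
      ... | g∈H' , _ , g≢a₃ | inj₂ a₃∋x = H'-matching _ a₃ g∈H' a₃∈H' g≢a₃ _ g∋x a₃∋x
      K∩K'=∅ : ∀ g → g ∈ K → g ∉ R ∪ ⁅ f ⁆
      K∩K'=∅ g g∈K g∈K' with x∈p∪⁅y⁆⁻ {p = R} g∈K'
      ... | inj₁ g∈R = K∩R=∅ g g∈K g∈R
      ... | inj₂ refl with ∈K⁻ g∈K
      ...   | inj₁ (_ , f≢f)   = f≢f refl
      ...   | inj₂ (inj₁ refl) = a₁∉H f∈H
      ...   | inj₂ (inj₂ refl) = a₃∉H f∈H

    exchange : Dec (a₁ ∈ H') → Dec (a₃ ∈ H') → ⊥
    exchange (no a₁∉H') _ = no-improving-exchange K R KR ∣H∣<∣K∣ (begin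
      ∣ H' ∣              ≤⟨ x∉p⇒∣p∣≤∣p-x∣ a₁∉H' ⟩
      ∣ H' - a₁ ∣         ≤⟨ ∣p∣≤1+∣p-x∣ (H' - a₁) a₃ ⟩
      suc ∣ R ∣           ∎)
      where open ≤-Reasoning
    exchange (yes _) (no a₃∉H') = no-improving-exchange K R KR ∣H∣<∣K∣ (begin
      ∣ H' ∣              ≤⟨ ∣p∣≤1+∣p-x∣ H' a₁ ⟩
      suc ∣ H' - a₁ ∣     ≤⟨ s≤s (x∉p⇒∣p∣≤∣p-x∣ (a₃∉H' ∘ proj₁ ∘ x∈p-y⁻ {p = H'})) ⟩
      suc ∣ R ∣           ∎)
      where open ≤-Reasoning
    exchange (yes a₁∈H') (yes a₃∈H') = no-improving-exchange K (R ∪ ⁅ f ⁆) (KRf a₁∈H' a₃∈H') ∣H∣<∣K∣ (begin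
      ∣ H' ∣              ≤⟨ ∣p∣≤1+∣p-x∣ H' a₁ ⟩
      suc ∣ H' - a₁ ∣     ≤⟨ s≤s (∣p∣≤1+∣p-x∣ (H' - a₁) a₃) ⟩
      suc (suc ∣ R ∣)     ≤⟨ s≤s (x∉p⇒∣p∣<∣p∪⁅x⁆∣ (H∩H'=∅ f f∈H ∘ proj₁ ∘ ∈R⁻)) ⟩
      suc ∣ R ∪ ⁅ f ⁆ ∣   ∎)
      where open ≤-Reasoning

    no-augmenting-path-of-length-3 : ⊥
    no-augmenting-path-of-length-3 = exchange (a₁ ∈? H') (a₃ ∈? H')

  open AugmentingPath3 using (no-augmenting-path-of-length-3) public

-- Alternating walks

iterate : (A → A) → A → ℕ → A
iterate next x zero    = x
iterate next x (suc i) = next (iterate next x i)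

colourAt : Bool → ℕ → Bool
colourAt c zero    = c
colourAt c (suc i) = colourAt (not c) i

colourAt-even : ∀ c i → colourAt c i ≡ c → ∃[ j ] i ≡ 2 * j
colourAt-odd  : ∀ c i → colourAt c i ≡ not c → ∃[ j ] i ≡ suc (2 * j)
colourAt-even c zero    _ = 0 , refl
colourAt-even c (suc i) p with colourAt-odd (not c) i (trans p (sym (not-involutive c)))
... | j , refl = suc j , cong suc (sym (+-suc j (j + 0)))
colourAt-odd c zero    p = ⊥-elim (not-¬ refl p)
colourAt-odd c (suc i) p with colourAt-even (not c) i p
... | j , refl = j , refl

colourAt-suc : ∀ c i → colourAt c (suc i) ≡ not (colourAt c i)
colourAt-suc c zero    = refl
colourAt-suc c (suc i) = colourAt-suc (not c) i

applyUpTo-last-two : ∀ (f : ℕ → A) j → applyUpTo f (2 + j) ≡ applyUpTo f j ++ f j ∷ f (1 + j) ∷ []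
applyUpTo-last-two f zero    = refl
applyUpTo-last-two f (suc j) = cong (f 0 ∷_) (applyUpTo-last-two (f ∘ suc) j)

module AlternatingWalks {G : Graph} {M H : EdgeSet G} (M-matching : Matching G M) (H-matching : Matching G H) where

  open GraphFacts G

  Vertex = Fin (n G)
  Edge   = Fin (m G)

  side : Bool → EdgeSet G
  side true  = M
  side false = H

  side-matching : ∀ c → Matching G (side c)
  side-matching true  = M-matching
  side-matching false = H-matching

  Coloured : Bool → Edge → Set
  Coloured c e = e ∈ side c × e ∉ side (not c)

  coloured? : ∀ c e → Dec (Coloured c e)
  coloured? c e = (e ∈? side c) ×-dec ¬? (e ∈? side (not c))

  coloured-unique : ∀ {c e f v} → Coloured c e → Coloured c f → Incident G e v → Incident G f v → e ≡ f
  coloured-unique {c} (e∈ , _) (f∈ , _) = matching-unique (side-matching c) e∈ f∈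

  -- In state (v , c) a walk stands at v and leaves along an edge of colour c.
  State = Vertex × Bool

  reversed : State → State
  reversed (v , c) = v , not c

  _—[_]→_ : State → Edge → State → Set
  (v , c) —[ e ]→ (w , c') = c' ≡ not c × Coloured c e × Joins G e v w

  Step : State → State → Set
  Step s t = ∃[ e ] s —[ e ]→ t

  Source : State → Set
  Source s = ∀ t → ¬ Step t s

  step-deterministic : ∀ {s t t'} → Step s t → Step s t' → t ≡ t'
  step-deterministic (e , refl , e∈ , j) (e' , refl , e'∈ , j')
    with refl ← coloured-unique e∈ e'∈ (joins-incidentˡ j) (joins-incidentˡ j')
    = cong (_, _) (joins-functional j j')

  step-injective : ∀ {s s' t} → Step s t → Step s' t → s ≡ s'
  step-injective {_ , c} {_ , c'} (e , c≡ , e∈ , j) (e' , c'≡ , e'∈ , j')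
    with refl ← not-injective (trans (sym c≡) c'≡)
    with refl ← coloured-unique e∈ e'∈ (joins-incidentʳ j) (joins-incidentʳ j')
    = cong (_, c) (joins-functional (joins-sym j) (joins-sym j'))

  step-reverse : ∀ {v c w c'} → Step (v , c) (w , c') → Step (w , not c') (v , not c)
  step-reverse {c = c} (e , refl , e∈ , j) rewrite not-involutive c = e , refl , e∈ , joins-sym j

  step-irreflexive : ∀ {v c c'} → ¬ Step (v , c) (v , c')
  step-irreflexive (_ , _ , _ , j) = joins-irreflexive j

  -- A walk that starts at a source never revisits a vertex: a repeated state would, by
  -- injectivity of steps, lead back to the source, and a repeated vertex with the opposite
  -- colour would, unwinding steps pairwise, force a step from a vertex to itself.
  module _ (s : ℕ → State) (K : ℕ) (steps : ∀ {i} → i < K → Step (s i) (s (suc i)))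
           (source : Source (s 0)) where

    states-distinct : ∀ {i j} → i < j → j ≤ K → s j ≢ s i
    states-distinct {zero}  {suc j} _          j<K s≡ = source (s j) (subst (Step (s j)) s≡ (steps j<K))
    states-distinct {suc i} {suc j} (s≤s i<j) j<K s≡ =
      states-distinct i<j (<⇒≤ j<K)
        (step-injective (steps j<K) (subst (Step (s i)) (sym s≡) (steps (<-trans i<j j<K))))

    never-reversed : ∀ d {i} → d + i ≤ K → s (d + i) ≢ reversed (s i)
    never-reversed zero          {i} _   s≡ = not-¬ refl (cong proj₂ s≡)
    never-reversed (suc zero)    {i} i<K s≡ = step-irreflexive (subst (Step (s i)) s≡ (steps i<K))
    never-reversed (suc (suc d)) {i} ≤K  s≡ =
      never-reversed d {suc i} (subst (_≤ K) (sym d+1+i) (<⇒≤ ≤K))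
        (trans (cong s d+1+i) (step-injective (steps ≤K) (subst (Step (reversed (s (suc i)))) (sym s≡) back)))
      where
      d+1+i : d + suc i ≡ suc (d + i)
      d+1+i = +-suc d i
      back : Step (reversed (s (suc i))) (reversed (s i))
      back = step-reverse (steps {i} (≤-trans (s≤s (m≤n+m i d)) (<⇒≤ ≤K)))

    vertices-distinct : ∀ {i j} → i < j → j ≤ K → proj₁ (s i) ≢ proj₁ (s j)
    vertices-distinct {i} {j} i<j j≤K v≡ with proj₂ (s i) ≟ᵇ proj₂ (s j)
    ... | yes c≡ = states-distinct i<j j≤K (sym (cong₂ _,_ v≡ c≡))
    ... | no  c≢ = never-reversed (j ∸ i) (subst (_≤ K) (sym j-i+i) j≤K)
                     (trans (cong s j-i+i) (cong₂ _,_ (sym v≡) (¬-not (c≢ ∘ sym))))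
      where
      j-i+i : j ∸ i + i ≡ j
      j-i+i = m∸n+n≡m (<⇒≤ i<j)

  Moves : State → Set
  Moves (v , c) = ∃[ e ] Coloured c e × Incident G e v

  moves? : ∀ s → Dec (Moves s)
  moves? (v , c) = any? λ e → coloured? c e ×-dec incident? e v

  -- The walk from a state; the fallback edge is only returned where no step exists.
  module Walks (fallback : Edge) where

    opaque
      next : State → State
      next (v , c) with moves? (v , c)
      ... | yes (e , _) = opposite e v , not c
      ... | no  _       = v , c

      edgeAt : State → Edge
      edgeAt s with moves? s
      ... | yes (e , _) = e
      ... | no  _       = fallback

      next-step : ∀ s → Moves s → s —[ edgeAt s ]→ next s
      next-step (v , c) moves with moves? (v , c)
      ... | yes (e , e∈ , e∋v) = refl , e∈ , incident⇒joins-opposite e∋v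
      ... | no  stuck          = ⊥-elim (stuck moves)

    record Walk (s₀ : State) : Set where
      field
        steps  : ℕ
        moves  : ∀ {i} → i < steps → Moves (iterate next s₀ i)
        stuck  : ¬ Moves (iterate next s₀ steps)

    first-stuck : ∀ s₀ K → (∀ {i} → i < K → Moves (iterate next s₀ i))
      ⊎ ∃[ L ] L < K × (∀ {i} → i < L → Moves (iterate next s₀ i)) × ¬ Moves (iterate next s₀ L)
    first-stuck s₀ zero = inj₁ λ ()
    first-stuck s₀ (suc K) with first-stuck s₀ K
    ... | inj₂ (L , L<K , moves , stuck) = inj₂ (L , m≤n⇒m≤1+n L<K , moves , stuck)
    ... | inj₁ moves with moves? (iterate next s₀ K)
    ...   | no  stuck = inj₂ (K , ≤-refl , moves , stuck)
    ...   | yes moves-K = inj₁ moves′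
      where
      moves′ : ∀ {i} → i < suc K → Moves (iterate next s₀ i)
      moves′ {i} (s≤s i≤K) with m≤n⇒m<n∨m≡n i≤K
      ... | inj₁ i<K  = moves i<K
      ... | inj₂ refl = moves-K

    -- A walk from a source cannot move n(G) + 1 times, by the pigeonhole principle.
    walk : ∀ s₀ → Source s₀ → Walk s₀
    walk s₀ source with first-stuck s₀ (suc (n G))
    ... | inj₂ (L , _ , moves , stuck) = record { steps = L ; moves = moves ; stuck = stuck }
    ... | inj₁ moves with pigeonhole (n<1+n (n G)) (λ i → proj₁ (iterate next s₀ (toℕ i)))
    ...   | i , j , i<j , v≡ =
      ⊥-elim (vertices-distinct (iterate next s₀) (suc (n G)) (λ i<K → _ , next-step _ (moves i<K)) source
                i<j (toℕ≤n j) v≡)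

  applyUpTo-connects : ∀ K (w : ℕ → Vertex) (ed : ℕ → Edge) →
    (∀ {i} → i < K → Joins G (ed i) (w i) (w (suc i))) → Connects G (applyUpTo w (suc K)) (applyUpTo ed K)
  applyUpTo-connects zero    w ed joins = tt
  applyUpTo-connects (suc K) w ed joins =
    joins (s≤s z≤n) , applyUpTo-connects K (w ∘ suc) (ed ∘ suc) (joins ∘ s≤s)

  applyUpTo-alternating : ∀ c (ed : ℕ → Edge) K → (∀ {i} → i < K → Coloured (colourAt c i) (ed i)) →
    AltSeq (side c) (side (not c)) (applyUpTo ed K)
  applyUpTo-alternating c     ed zero    coloured = tt
  applyUpTo-alternating true  ed (suc K) coloured =
    coloured (s≤s z≤n) , applyUpTo-alternating false (ed ∘ suc) K (coloured ∘ s≤s)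
  applyUpTo-alternating false ed (suc K) coloured =
    coloured (s≤s z≤n) , applyUpTo-alternating true (ed ∘ suc) K (coloured ∘ s≤s)

  Opposite : Edge → Edge → Set
  Opposite a b = ∃[ c ] Coloured c a × Coloured (not c) b

  Adjacent : Edge → Edge → Set
  Adjacent a b = ∃[ v ] Incident G a v × Incident G b v

  opposite-sym : ∀ {a b} → Opposite a b → Opposite b a
  opposite-sym (c , a∈ , b∈) = not c , b∈ , subst (λ c' → Coloured c' _) (sym (not-involutive c)) a∈

  record LocallyAlternating (fs : List Edge) : Set where
    field
      consecutive : ∀ xs a b ys → xs ++ a ∷ b ∷ ys ≡ fs → Opposite a b × Adjacent a b
      two-apart   : ∀ xs a b d ys → xs ++ a ∷ b ∷ d ∷ ys ≡ fs → a ≢ d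

  alternating-path-local : ∀ fs → IsAltPath G M H fs → LocallyAlternating fs
  alternating-path-local fs ((vs , vs-unique , connects) , _ , alternates) = record
    { consecutive = λ { xs a b ys refl → opposite-at xs alternates , adjacent-at vs xs connects }
    ; two-apart   = λ { xs a b d ys refl → distinct-at vs xs vs-unique connects }
    }
    where
    AltSeq-opposite : ∀ c xs {a b ys} → AltSeq (side c) (side (not c)) (xs ++ a ∷ b ∷ ys) → Opposite a b
    AltSeq-opposite true  []       (a∈ , b∈ , _) = true , a∈ , b∈
    AltSeq-opposite false []       (a∈ , b∈ , _) = false , a∈ , b∈
    AltSeq-opposite true  (_ ∷ xs) (_ , rest)    = AltSeq-opposite false xs rest
    AltSeq-opposite false (_ ∷ xs) (_ , rest)    = AltSeq-opposite true xs rest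

    opposite-at : ∀ xs {a b ys} → AltSeq M H (xs ++ a ∷ b ∷ ys) ⊎ AltSeq H M (xs ++ a ∷ b ∷ ys) → Opposite a b
    opposite-at xs (inj₁ alt) = AltSeq-opposite true xs alt
    opposite-at xs (inj₂ alt) = AltSeq-opposite false xs alt

    adjacent-at : ∀ vs xs {a b ys} → Connects G vs (xs ++ a ∷ b ∷ ys) → Adjacent a b
    adjacent-at (_ ∷ v ∷ _ ∷ _) []       (ja , jb , _) = v , joins-incidentʳ ja , joins-incidentˡ jb
    adjacent-at (_ ∷ v ∷ vs)    (_ ∷ xs) (_ , rest)    = adjacent-at (v ∷ vs) xs rest

    distinct-at : ∀ vs xs {a b d ys} → Unique vs → Connects G vs (xs ++ a ∷ b ∷ d ∷ ys) → a ≢ d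
    distinct-at (_ ∷ v ∷ w ∷ z ∷ _) [] (_ ∷ (v≢w ∷ v≢z ∷ _) ∷ _) (ja , _ , jd , _) refl
      with incident-joins jd (joins-incidentʳ ja)
    ... | inj₁ v≡w = v≢w v≡w
    ... | inj₂ v≡z = v≢z v≡z
    distinct-at (_ ∷ v ∷ vs) (_ ∷ xs) (_ ∷ vs-unique) (_ , rest) = distinct-at (v ∷ vs) xs vs-unique rest

  locally-alternating-reverse : ∀ fs → LocallyAlternating fs → LocallyAlternating (reverse fs)
  locally-alternating-reverse fs local = record
    { consecutive = λ xs a b ys eq →
        Product.map opposite-sym adjacent-sym
          (consecutive (reverse ys) b a (reverse xs) (unreverse xs (a ∷ b ∷ []) ys eq))
    ; two-apart = λ xs a b d ys eq a≡d →
        two-apart (reverse ys) d b a (reverse xs) (unreverse xs (a ∷ b ∷ d ∷ []) ys eq) (sym a≡d)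
    }
    where
    open LocallyAlternating local
    adjacent-sym : ∀ {a b} → Adjacent a b → Adjacent b a
    adjacent-sym (v , a∋v , b∋v) = v , b∋v , a∋v
    unreverse : ∀ xs zs ys → xs ++ zs ++ ys ≡ reverse fs → reverse ys ++ reverse zs ++ reverse xs ≡ fs
    unreverse xs zs ys eq = begin
      reverse ys ++ reverse zs ++ reverse xs   ≡⟨ ++-assoc (reverse ys) (reverse zs) (reverse xs) ⟨
      (reverse ys ++ reverse zs) ++ reverse xs ≡⟨ cong (_++ reverse xs) (reverse-++ zs ys) ⟨
      reverse (zs ++ ys) ++ reverse xs         ≡⟨ reverse-++ xs (zs ++ ys) ⟨
      reverse (xs ++ zs ++ ys)                 ≡⟨ cong reverse eq ⟩
      reverse (reverse fs)                     ≡⟨ reverse-involutive fs ⟩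
      fs                                       ∎
      where open ≡-Reasoning

  -- An alternating path is maximal as soon as its first and last edges cannot be
  -- continued outwards: any extension would put the continuing edge two steps from itself.
  module _ (e₁ e₂ : Edge) (rest pre : List Edge) (a b : Edge) (es≡ : e₁ ∷ e₂ ∷ rest ≡ pre ++ a ∷ b ∷ [])
           (front-blocked : ∀ g → Opposite g e₁ → Adjacent g e₁ → g ≡ e₂)
           (back-blocked : ∀ g → Opposite b g → Adjacent b g → g ≡ a) where

    extension-impossible : ∀ gs → LocallyAlternating gs → length (e₁ ∷ e₂ ∷ rest) < length gs →
                           ∀ xs ys → xs ++ (e₁ ∷ e₂ ∷ rest) ++ ys ≡ gs → ⊥
    extension-impossible gs local longer xs ys eq with initLast xs
    ... | xs' ∷ʳ′ g = two-apart xs' g e₁ e₂ (rest ++ ys) eq′ (front-blocked g g-opp g-adj)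
      where
      open LocallyAlternating local
      eq′ : xs' ++ g ∷ e₁ ∷ e₂ ∷ rest ++ ys ≡ gs
      eq′ = trans (sym (++-assoc xs' (g ∷ []) (e₁ ∷ e₂ ∷ rest ++ ys))) eq
      g-opp : Opposite g e₁
      g-opp = proj₁ (consecutive xs' g e₁ (e₂ ∷ rest ++ ys) eq′)
      g-adj : Adjacent g e₁
      g-adj = proj₂ (consecutive xs' g e₁ (e₂ ∷ rest ++ ys) eq′)
    ... | [] with ys
    ...   | [] = <-irrefl (cong length (trans (sym (++-identityʳ (e₁ ∷ e₂ ∷ rest))) eq)) longer
    ...   | g ∷ ys' = two-apart pre a b g ys' eq₁ (sym (back-blocked g g-opp g-adj))
      where
      open LocallyAlternating local
      eq₁ : pre ++ a ∷ b ∷ g ∷ ys' ≡ gs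
      eq₁ = trans (sym (++-assoc pre (a ∷ b ∷ []) (g ∷ ys'))) (trans (cong (_++ g ∷ ys') (sym es≡)) eq)
      eq₂ : (pre ++ a ∷ []) ++ b ∷ g ∷ ys' ≡ gs
      eq₂ = trans (++-assoc pre (a ∷ []) (b ∷ g ∷ ys')) eq₁
      g-opp : Opposite b g
      g-opp = proj₁ (consecutive (pre ++ a ∷ []) b g ys' eq₂)
      g-adj : Adjacent b g
      g-adj = proj₂ (consecutive (pre ++ a ∷ []) b g ys' eq₂)

    maximal-if-ends-blocked : ∀ fs → IsAltPath G M H fs → ¬ ProperSubpath (e₁ ∷ e₂ ∷ rest) fs
    maximal-if-ends-blocked fs fs-path (longer , xs , ys , inj₁ eq) =
      extension-impossible fs (alternating-path-local fs fs-path) longer xs ys eq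
    maximal-if-ends-blocked fs fs-path (longer , xs , ys , inj₂ eq) =
      extension-impossible (reverse fs) (locally-alternating-reverse fs (alternating-path-local fs fs-path))
        (subst (length (e₁ ∷ e₂ ∷ rest) <_) (sym (length-reverse fs)) longer) xs ys eq

  -- Chains are stored from the target back to the source, so that two chains into the same
  -- state can be compared step by step from their common end.
  Reaches : State → State → Set
  Reaches s t = Star (flip Step) t s

  reaches-source-unique : ∀ {s s' t} → Source s → Source s' → Reaches s t → Reaches s' t → s ≡ s'
  reaches-source-unique source source' ε          ε            = refl
  reaches-source-unique source source' ε          (step ◅ _)   = ⊥-elim (source _ step)
  reaches-source-unique source source' (step ◅ _) ε            = ⊥-elim (source' _ step)
  reaches-source-unique source source' (step ◅ r) (step' ◅ r')
    with refl ← step-injective step step' = reaches-source-unique source source' r r'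

  H-exposed-source : ∀ {v} → Exposed G H v → Source (v , true)
  H-exposed-source exposed (_ , true)  (_ , () , _)
  H-exposed-source exposed (_ , false) (_ , _ , (e∈H , _) , j) = exposed e∈H (joins-incidentʳ j)

  coloured-functional : ∀ {c c' e} → Coloured c e → Coloured c' e → c ≡ c'
  coloured-functional {true}  {true}  _        _        = refl
  coloured-functional {true}  {false} (e∈ , _) (_ , e∉) = ⊥-elim (e∉ e∈)
  coloured-functional {false} {true}  (e∈ , _) (_ , e∉) = ⊥-elim (e∉ e∈)
  coloured-functional {false} {false} _        _        = refl

  opposite-colour : ∀ {c a g} → Coloured c a → Opposite a g → Coloured (not c) g
  opposite-colour a-col (c' , a-col' , g-col) with refl ← coloured-functional a-col a-col' = g-col

  stuck⇒H-exposed : ∀ {a x} → Coloured true a → Incident G a x → ¬ Moves (x , false) → Exposed G H x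
  stuck⇒H-exposed {a} (a∈M , a∉H) a∋x stuck {g} g∈H g∋x with g ∈? M
  ... | no  g∉M = stuck (g , (g∈H , g∉M) , g∋x)
  ... | yes g∈M with refl ← matching-unique M-matching g∈M a∈M g∋x a∋x = a∉H g∈H

  module Outcomes {H' : EdgeSet G} (HH' : B2 G H H') (first-maximal : FirstMaximal G H H') where

    open Exchange {G} {H} {H'} HH' first-maximal

    -- What the walk from an H-exposed vertex v along its M-edge produces: either it ends in
    -- an H-edge at an M-exposed vertex, or it is a path of P_o^M(M,H) of length at least 5,
    -- recorded through its second edge f = w₁w₂ and the step from w₂.
    data Outcome (v : Vertex) : Set where
      ends-M-exposed : ∀ f b → f ∈ H → Reaches (v , true) (endpoint G f b , true) →
                       Exposed G M (endpoint G f b) → Outcome v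
      long-path      : ∀ f {w₁ w₂ w₃} → InHA G H M f → Joins G f w₁ w₂ → Step (v , true) (w₁ , false) →
                       Step (w₂ , true) (w₃ , false) → Moves (w₃ , false) → Outcome v

    module _ {v} (v-exposed : Exposed G H v) {e₀} (e₀∈M : e₀ ∈ M) (e₀∋v : Incident G e₀ v) where

      open Walks e₀

      s : ℕ → State
      s = iterate next (v , true)

      w : ℕ → Vertex
      w i = proj₁ (s i)

      ed : ℕ → Edge
      ed i = edgeAt (s i)

      Moving : ℕ → Set
      Moving L = ∀ {i} → i < L → Moves (s i)

      module Along (L : ℕ) (moving : Moving L) (stuck : ¬ Moves (s L)) where

        step-at : ∀ {i} → i < L → s i —[ ed i ]→ s (suc i)
        step-at {i} i<L = next-step (s i) (moving i<L)

        colour-at : ∀ {i} → i ≤ L → proj₂ (s i) ≡ colourAt true i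
        colour-at {zero}  _       = refl
        colour-at {suc i} i<L = begin
          proj₂ (s (suc i))        ≡⟨ proj₁ (step-at i<L) ⟩
          not (proj₂ (s i))        ≡⟨ cong not (colour-at (<⇒≤ i<L)) ⟩
          not (colourAt true i)    ≡⟨ colourAt-suc true i ⟨
          colourAt true (suc i)    ∎
          where open ≡-Reasoning

        state-at : ∀ {i} → i ≤ L → s i ≡ (w i , colourAt true i)
        state-at {i} i≤L = cong (w i ,_) (colour-at i≤L)

        coloured : ∀ {i} → i < L → Coloured (colourAt true i) (ed i)
        coloured {i} i<L = subst (λ c → Coloured c (ed i)) (colour-at (<⇒≤ i<L)) (proj₁ (proj₂ (step-at i<L)))

        joins : ∀ {i} → i < L → Joins G (ed i) (w i) (w (suc i))
        joins i<L = proj₂ (proj₂ (step-at i<L))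

        step-between : ∀ {i} → i < L → Step (w i , colourAt true i) (w (suc i) , colourAt true (suc i))
        step-between i<L = subst₂ Step (state-at (<⇒≤ i<L)) (state-at i<L) (_ , step-at i<L)

        distinct : ∀ {i j} → i < j → j ≤ L → w i ≢ w j
        distinct = vertices-distinct s L (λ i<L → _ , step-at i<L) (H-exposed-source v-exposed)

        stuck-at-end : ¬ Moves (w L , colourAt true L)
        stuck-at-end = subst (λ t → ¬ Moves t) (state-at ≤-refl) stuck

        reaches : ∀ {i} → i ≤ L → Reaches (v , true) (s i)
        reaches {zero}  _   = ε
        reaches {suc i} i<L = (_ , step-at i<L) ◅ reaches (<⇒≤ i<L)

        walk-path : IsPath G (applyUpTo ed L)
        walk-path = applyUpTo w (suc L)
                  , Unique.applyUpTo⁺₁ w (suc L) (λ i<j j<1+L → distinct i<j (≤-pred j<1+L))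
                  , applyUpTo-connects L w ed joins

        walk-alternates : AltSeq M H (applyUpTo ed L)
        walk-alternates = applyUpTo-alternating true ed L coloured

        same-colour-at : ∀ {i g x} → i < L → Coloured (colourAt true i) g → Incident G g x →
                         x ≡ w i ⊎ x ≡ w (suc i) → g ≡ ed i
        same-colour-at i<L g-col g∋x (inj₁ refl) = coloured-unique g-col (coloured i<L) g∋x (joins-incidentˡ (joins i<L))
        same-colour-at i<L g-col g∋x (inj₂ refl) = coloured-unique g-col (coloured i<L) g∋x (joins-incidentʳ (joins i<L))

      e₀-coloured : Coloured true e₀
      e₀-coloured = e₀∈M , λ e₀∈H → v-exposed e₀∈H e₀∋v

      ends-even : ∀ l → Moving (suc l) → ¬ Moves (s (suc l)) → colourAt true (suc l) ≡ true → Outcome v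
      ends-even l moving stuck parity = ends-M-exposed f b (proj₁ f-coloured) reached M-exposed
        where
        open Along (suc l) moving stuck
        f = ed l
        f-coloured : Coloured false f
        f-coloured = subst (λ c → Coloured c f) (not-injective (trans (sym (colourAt-suc true l)) parity))
                       (coloured ≤-refl)
        f∋end : Incident G f (w (suc l))
        f∋end = joins-incidentʳ (joins ≤-refl)
        b = proj₁ (incident-endpoint f∋end)
        endpoint≡ : endpoint G f b ≡ w (suc l)
        endpoint≡ = proj₂ (incident-endpoint f∋end)
        reached : Reaches (v , true) (endpoint G f b , true)
        reached = subst (Reaches (v , true)) (trans (state-at ≤-refl) (cong₂ _,_ (sym endpoint≡) parity))
                    (reaches ≤-refl)
        M-exposed : Exposed G M (endpoint G f b)
        M-exposed {g} g∈M g∋x with g ∈? H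
        ... | yes g∈H = proj₂ f-coloured (subst (_∈ M) (matching-unique H-matching g∈H (proj₁ f-coloured) g∋x
                          (subst (Incident G f) (sym endpoint≡) f∋end)) g∈M)
        ... | no  g∉H = stuck-at-end (g , subst (λ c → Coloured c g) (sym parity) (g∈M , g∉H) ,
                          subst (Incident G g) endpoint≡ g∋x)

      not-length-one : Moving 1 → ¬ ¬ Moves (s 1)
      not-length-one moving stuck = no-augmenting-edge (proj₂ (coloured z<s)) ends-exposed
        where
        open Along 1 moving stuck
        ends-exposed : ∀ {x} → Incident G (ed 0) x → Exposed G H x
        ends-exposed e∋x with incident-joins (joins z<s) e∋x
        ... | inj₁ refl = v-exposed
        ... | inj₂ refl = stuck⇒H-exposed (coloured z<s) (joins-incidentʳ (joins z<s)) stuck-at-end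

      not-length-three : Moving 3 → ¬ ¬ Moves (s 3)
      not-length-three moving stuck =
        no-augmenting-path-of-length-3 (proj₂ a₁-coloured) (proj₂ a₃-coloured) (proj₁ f-coloured)
          apart f-between at-a₁ at-a₃
        where
        open Along 3 moving stuck
        0<3 : 0 < 3
        0<3 = z<s
        1<3 : 1 < 3
        1<3 = s<s z<s
        2<3 : 2 < 3
        2<3 = s<s (s<s z<s)
        a₁-coloured : Coloured true (ed 0)
        a₁-coloured = coloured 0<3
        f-coloured : Coloured false (ed 1)
        f-coloured = coloured 1<3
        a₃-coloured : Coloured true (ed 2)
        a₃-coloured = coloured 2<3
        a₁≢a₃ : ed 0 ≢ ed 2
        a₁≢a₃ eq with incident-joins (joins 2<3) (subst (λ a → Incident G a (w 1)) eq (joins-incidentʳ (joins 0<3)))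
        ... | inj₁ w₁≡w₂ = distinct (s<s z<s) (<⇒≤ 2<3) w₁≡w₂
        ... | inj₂ w₁≡w₃ = distinct 1<3 ≤-refl w₁≡w₃
        apart : ∀ {x} → Incident G (ed 0) x → ¬ Incident G (ed 2) x
        apart a₁∋x a₃∋x = M-matching (ed 0) (ed 2) (proj₁ a₁-coloured) (proj₁ a₃-coloured) a₁≢a₃ _ a₁∋x a₃∋x
        f-between : ∀ {x} → Incident G (ed 1) x → Incident G (ed 0) x ⊎ Incident G (ed 2) x
        f-between f∋x with incident-joins (joins 1<3) f∋x
        ... | inj₁ refl = inj₁ (joins-incidentʳ (joins 0<3))
        ... | inj₂ refl = inj₂ (joins-incidentˡ (joins 2<3))
        at-a₁ : ∀ {g x} → g ∈ H → Incident G (ed 0) x → Incident G g x → g ≡ ed 1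
        at-a₁ g∈H a₁∋x g∋x with incident-joins (joins 0<3) a₁∋x
        ... | inj₁ refl = ⊥-elim (v-exposed g∈H g∋x)
        ... | inj₂ refl = matching-unique H-matching g∈H (proj₁ f-coloured) g∋x (joins-incidentˡ (joins 1<3))
        at-a₃ : ∀ {g x} → g ∈ H → Incident G (ed 2) x → Incident G g x → g ≡ ed 1
        at-a₃ g∈H a₃∋x g∋x with incident-joins (joins 2<3) a₃∋x
        ... | inj₁ refl = matching-unique H-matching g∈H (proj₁ f-coloured) g∋x (joins-incidentʳ (joins 1<3))
        ... | inj₂ refl = ⊥-elim (stuck⇒H-exposed a₃-coloured (joins-incidentʳ (joins 2<3)) stuck-at-end g∈H g∋x)

      long : ∀ j → Moving (suc (2 * (2 + j))) → ¬ Moves (s (suc (2 * (2 + j)))) → Outcome v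
      long j moving stuck =
        long-path (ed 1) (proj₁ (coloured 1<L) , es , es-path , Any.applyUpTo⁺ ed refl 1<L)
          (joins 1<L) (step-between z<s) (step-between 2<L) (subst Moves (state-at (<⇒≤ 3<L)) (moving 3<L))
        where
        L = suc (2 * (2 + j))
        -- chosen so that L reduces to 2 + X
        X = suc (j + suc (suc (j + 0)))
        open Along L moving stuck
        1<L : 1 < L
        1<L = s<s z<s
        2<L : 2 < L
        2<L = s<s (s<s z<s)
        3<L : 3 < L
        3<L = s<s (s<s (s<s (<-≤-trans z<s (m≤n+m _ j))))
        es = applyUpTo ed L
        front-blocked : ∀ g → Opposite g (ed 0) → Adjacent g (ed 0) → g ≡ ed 1
        front-blocked g opp (x , g∋x , e∋x) with incident-joins (joins z<s) e∋x
        ... | inj₁ refl = ⊥-elim (v-exposed (proj₁ (opposite-colour (coloured z<s) (opposite-sym opp))) g∋x)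
        ... | inj₂ x≡w₁ = same-colour-at 1<L (opposite-colour (coloured z<s) (opposite-sym opp)) g∋x (inj₁ x≡w₁)
        after-last : ∀ {g} → Opposite (ed (suc X)) g → Coloured (colourAt true L) g
        after-last {g} opp = subst (λ c → Coloured c g) (sym (colourAt-suc true (suc X)))
                               (opposite-colour (coloured ≤-refl) opp)
        back-blocked : ∀ g → Opposite (ed (suc X)) g → Adjacent (ed (suc X)) g → g ≡ ed X
        back-blocked g opp (x , e∋x , g∋x) with incident-joins (joins ≤-refl) e∋x
        ... | inj₁ x≡w = same-colour-at (<-trans (n<1+n X) (n<1+n (suc X))) (after-last opp) g∋x (inj₂ x≡w)
        ... | inj₂ refl = ⊥-elim (stuck-at-end (g , after-last opp , g∋x))
        es-path : InPoA G M H es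
        es-path = ( (walk-path , subst (1 ≤_) (sym (length-applyUpTo ed L)) (s≤s z≤n) , inj₁ walk-alternates)
                  , maximal-if-ends-blocked (ed 0) (ed 1) _ (applyUpTo ed X) (ed X) (ed (suc X))
                      (applyUpTo-last-two ed X) front-blocked back-blocked)
                , (2 + j , length-applyUpTo ed L)
                , (ed 0 , _ , refl , proj₁ (coloured z<s))

      analyse : ∀ L → Moving L → ¬ Moves (s L) → Outcome v
      analyse zero    moving stuck = ⊥-elim (stuck (e₀ , e₀-coloured , e₀∋v))
      analyse (suc l) moving stuck with colourAt true (suc l) in parity
      ... | true  = ends-even l moving stuck parity
      ... | false with colourAt-odd true (suc l) parity
      ...   | 0           , refl = ⊥-elim (not-length-one moving stuck)
      ...   | 1           , refl = ⊥-elim (not-length-three moving stuck)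
      ...   | suc (suc j) , refl = long j moving stuck

      walk-outcome : Outcome v
      walk-outcome = analyse (Walk.steps W) (Walk.moves W) (Walk.stuck W)
        where W = walk (v , true) (H-exposed-source v-exposed)

-- Charging the endpoints of M

module Charging {G : Graph} {M H H' : EdgeSet G} (M-matching : Matching G M) (HH' : B2 G H H')
  (first-maximal : FirstMaximal G H H') (HA : EdgeSet G) (HA-spec : ∀ e → (e ∈ HA) ⇔ InHA G H M e) where

  open GraphFacts G
  open AlternatingWalks {G} {M} {H} M-matching (proj₁ HH')
  open Outcomes {H'} HH' first-maximal

  Dart = Edge × Bool

  Target = Dart ⊎ Edge

  data Charged (e : Edge) (b : Bool) : Target → Set where
    covered : ∀ {f b'} → endpoint G f b' ≡ endpoint G e b → Charged e b (inj₁ (f , b'))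
    walked  : ∀ {f b'} → Exposed G H (endpoint G e b) → Reaches (endpoint G e b , true) (endpoint G f b' , true) →
              Exposed G M (endpoint G f b') → Charged e b (inj₁ (f , b'))
    passed  : ∀ {f w₁ w₂ w₃} → Exposed G H (endpoint G e b) → Joins G f w₁ w₂ →
              Step (endpoint G e b , true) (w₁ , false) → Step (w₂ , true) (w₃ , false) → Moves (w₃ , false) →
              Charged e b (inj₂ f)

  _charged-to_ : Dart → Target → Set
  (e , b) charged-to t = e ∈ M × Charged e b t

  charge-injective : ∀ {d d' t} → d charged-to t → d' charged-to t → d ≡ d'
  charge-injective (e∈M , covered same) (e'∈M , covered same') =
    matching-dart-injective M-matching e∈M e'∈M (trans (sym same) same')
  charge-injective {e , b} (e∈M , covered same) (_ , walked _ _ M-exposed) =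
    ⊥-elim (M-exposed e∈M (subst (Incident G e) (sym same) (endpoint-incident e b)))
  charge-injective {d' = e' , b'} (_ , walked _ _ M-exposed) (e'∈M , covered same') =
    ⊥-elim (M-exposed e'∈M (subst (Incident G e') (sym same') (endpoint-incident e' b')))
  charge-injective (e∈M , walked exposed reached _) (e'∈M , walked exposed' reached' _) =
    matching-dart-injective M-matching e∈M e'∈M
      (cong proj₁ (reaches-source-unique (H-exposed-source exposed) (H-exposed-source exposed') reached reached'))
  charge-injective (e∈M , passed exposed j first _ _) (e'∈M , passed _ j' first' third' moves')
    with joins-endpoints j j'
  ... | inj₁ (refl , _) = matching-dart-injective M-matching e∈M e'∈M (cong proj₁ (step-injective first first'))
  -- Traversing f the other way, the second walk would arrive at the start of the first one
  -- and then continue along an H-edge there.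
  ... | inj₂ (refl , refl) with refl ← step-deterministic third' (step-reverse first) =
    ⊥-elim (exposed (proj₁ (proj₁ (proj₂ moves'))) (proj₂ (proj₂ moves')))

  bools : List Bool
  bools = true ∷ false ∷ []

  ∈-bools : ∀ b → b ∈ₗ bools
  ∈-bools true  = here refl
  ∈-bools false = there (here refl)

  M-darts : List Dart
  M-darts = cartesianProduct (elements M) bools

  targets : List Target
  targets = map inj₁ (cartesianProduct (elements H) bools) ++ map inj₂ (elements HA)

  H-dart∈targets : ∀ {f} → f ∈ H → ∀ b → inj₁ (f , b) ∈ₗ targets
  H-dart∈targets f∈H b = ∈-++⁺ˡ (∈-map⁺ inj₁ (∈-cartesianProduct⁺ (∈-elements⁺ f∈H) (∈-bools b)))

  HA-edge∈targets : ∀ {f} → f ∈ HA → inj₂ f ∈ₗ targets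
  HA-edge∈targets f∈HA = ∈-++⁺ʳ _ (∈-map⁺ inj₂ (∈-elements⁺ f∈HA))

  charge : ∀ {d} → d ∈ₗ M-darts → ∃[ t ] t ∈ₗ targets × d charged-to t
  charge {e , b} d∈ with ∈-elements⁻ (proj₁ (∈-cartesianProduct⁻ (elements M) bools d∈))
  ... | e∈M with any? (λ g → (g ∈? H) ×-dec incident? g (endpoint G e b))
  ...   | yes (f , f∈H , f∋x) with b' , same ← incident-endpoint f∋x =
    inj₁ (f , b') , H-dart∈targets f∈H b' , e∈M , covered same
  ...   | no  covered-by-none = from-walk (walk-outcome {endpoint G e b} exposed e∈M (endpoint-incident e b))
    where
    exposed : Exposed G H (endpoint G e b)
    exposed f∈H f∋x = covered-by-none (_ , f∈H , f∋x)
    from-walk : Outcome (endpoint G e b) → ∃[ t ] t ∈ₗ targets × (e , b) charged-to t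
    from-walk (ends-M-exposed f b' f∈H reached M-exposed) =
      inj₁ (f , b') , H-dart∈targets f∈H b' , e∈M , walked exposed reached M-exposed
    from-walk (long-path f f∈HA j first third moves) =
      inj₂ f , HA-edge∈targets (Equivalence.from (HA-spec f) f∈HA) , e∈M , passed exposed j first third moves

  charging-bound : 2 * ∣ M ∣ ≤ 2 * ∣ H ∣ + ∣ HA ∣
  charging-bound = begin
    2 * ∣ M ∣                   ≡⟨ *-comm 2 ∣ M ∣ ⟩
    ∣ M ∣ * 2                   ≡⟨ cong (_* 2) (length-elements M) ⟨
    length (elements M) * 2     ≡⟨ length-cartesianProduct (elements M) bools ⟨
    length M-darts              ≤⟨ injection⇒length≤ _charged-to_ charge-injective M-darts-unique charge ⟩
    length targets              ≡⟨ length-targets ⟩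
    2 * ∣ H ∣ + ∣ HA ∣          ∎
    where
    open ≤-Reasoning
    M-darts-unique : Unique M-darts
    M-darts-unique = Unique.cartesianProduct⁺ (elements-unique M) (((λ ()) ∷ []) ∷ [] ∷ [])
    length-targets : length targets ≡ 2 * ∣ H ∣ + ∣ HA ∣
    length-targets = begin-equality
      length targets    ≡⟨ length-++ (map inj₁ (cartesianProduct (elements H) bools)) ⟩
      length (map inj₁ (cartesianProduct (elements H) bools)) + length (map inj₂ (elements HA))
        ≡⟨ cong₂ _+_ (length-map inj₁ (cartesianProduct (elements H) bools)) (length-map inj₂ (elements HA)) ⟩
      length (cartesianProduct (elements H) bools) + length (elements HA)
        ≡⟨ cong₂ _+_ (length-cartesianProduct (elements H) bools) (length-elements HA) ⟩
      length (elements H) * 2 + ∣ HA ∣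
        ≡⟨ cong (λ h → h * 2 + ∣ HA ∣) (length-elements H) ⟩
      ∣ H ∣ * 2 + ∣ HA ∣
        ≡⟨ cong (_+ ∣ HA ∣) (*-comm ∣ H ∣ 2) ⟩
      2 * ∣ H ∣ + ∣ HA ∣ ∎

ν≤∣maximum∣ : ∀ {G M ν} → MaximumMatching G M → IsNu G ν → ν ≤ ∣ M ∣
ν≤∣maximum∣ (_ , maximum) ((S , S-matching , ∣S∣≡ν) , _) = subst (_≤ _) ∣S∣≡ν (maximum S S-matching)

InM2⇒≤α₂ : ∀ {G H H' α₂} → InM2 G H H' → IsAlpha2 G α₂ → ∣ H ∣ ≤ α₂
InM2⇒≤α₂ {G} (HH' , l , _ , λ₂ , _ , total , _) (l' , λ₂' , _ , bound) =
  proj₁ (bound _ _ HH' (trans total (λ₂-unique {G} λ₂ λ₂')))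

corollary2 : (G : Graph) (ν α₂ : ℕ) → IsNu G ν → IsAlpha2 G α₂ →
    (H H' M : EdgeSet G) → StandingChoice G H H' M →
    (HA : EdgeSet G) → (∀ e → (e ∈ HA) ⇔ InHA G H M e) →
    2 * (ν ∸ α₂) ≤ ∣ HA ∣
corollary2 G ν α₂ is-ν is-α₂ H H' M ((HH'∈M₂ , M-maximum) , _) HA HA-spec = begin
  2 * (ν ∸ α₂)           ≤⟨ *-monoʳ-≤ 2 (∸-mono (ν≤∣maximum∣ {G} M-maximum is-ν) (InM2⇒≤α₂ {G} HH'∈M₂ is-α₂)) ⟩
  2 * (∣ M ∣ ∸ ∣ H ∣)     ≡⟨ *-distribˡ-∸ 2 ∣ M ∣ ∣ H ∣ ⟩
  2 * ∣ M ∣ ∸ 2 * ∣ H ∣   ≤⟨ m≤n+o⇒m∸n≤o (2 * ∣ M ∣) (2 * ∣ H ∣) charging-bound ⟩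
  ∣ HA ∣                 ∎
  where
  open ≤-Reasoning
  open Charging {G} {M} {H} {H'} (proj₁ M-maximum) (proj₁ HH'∈M₂) (InM2⇒FirstMaximal {G} HH'∈M₂) HA HA-spec
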